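{- Let $E$ be a finite set. There is a bijection from the set of shade maps $\operatorname{Shade}:\mathcal{P}(E)\to\mathcal{P}(E)$ to the set of Boolean interval partitions of $\mathcal{P}(E)$. It sends each shade map $\operatorname{Shade}$ to $\mathbf{P}=\{[F\cap\operatorname{Shade}F,\ F\cup(E\setminus\operatorname{Shade}F)]\mid F\in\mathcal{P}(E)\}$, and its inverse sends each Boolean interval partition $\mathbf{P}$ to the map $F\mapsto E\setminus(\tau(F)\setminus\alpha(F))$, where $[\alpha(F),\tau(F)]$ is the unique block of $\mathbf{P}$ containing $F$.
   Context: $\mathcal{P}(E)$ is the power set of $E$. For $U\subseteq V\subseteq E$, $[U,V]=\{I\in\mathcal{P}(E)\mid U\subseteq I\subseteq V\}$; a Boolean interval of $\mathcal{P}(E)$ is a set of this form (it determines $U$ and $V$). A Boolean interval partition of $\mathcal{P}(E)$ is a set of pairwise disjoint Boolean intervals of $\mathcal{P}(E)$ whose union is $\mathcal{P}(E)$; its elements are blocks. A shade map on $E$ is a map $S:\mathcal{P}(E)\to\mathcal{P}(E)$ such that for every $F\subseteq E$ and every $u\in E\setminus S(F)$ we have $S(F\cup\{u\})=S(F)$ and $S(F\setminus\{u\})=S(F)$. -}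

module Defs where

open import Data.Nat using (ℕ; zero; suc)
open import Data.Bool using (Bool; true; false; _∧_; T?)
open import Data.Bool.Properties using () renaming (_≟_ to _≟B_)
open import Data.Fin using (Fin)
open import Data.Fin.Subset using (Subset; _∉_; _⊆_; _∩_; _∪_; ∁; _─_; ⁅_⁆; _-_; ⊥; inside; outside)
open import Data.Fin.Subset.Properties using (_⊆?_)
open import Data.Vec using ([]; _∷_)
open import Data.Vec.Properties using (≡-dec)
open import Data.List using (List; []; _∷_; map; concatMap; filter; _++_)
open import Data.Bool.ListAction using (any)
open import Data.Product using (_×_; _,_; ∃-syntax)
open import Relation.Binary.PropositionalEquality using (_≡_)
open import Relation.Nullary using (does; ¬_)

-- E is modelled as Fin n; P(E) as Subset n (= Vec Bool n).

_=S_ : ∀ {n} → Subset n → Subset n → Bool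
U =S V = does (≡-dec _≟B_ U V)

_⊆B_ : ∀ {n} → Subset n → Subset n → Bool
U ⊆B V = does (U ⊆? V)

allSubsets : (n : ℕ) → List (Subset n)
allSubsets zero = [] ∷ []
allSubsets (suc n) = map (inside ∷_) (allSubsets n) ++ map (outside ∷_) (allSubsets n)

IsShadeMap : ∀ {n} → (Subset n → Subset n) → Set
IsShadeMap {n} S = ∀ (F : Subset n) (u : Fin n) → u ∉ S F →
  (S (F ∪ ⁅ u ⁆) ≡ S F) × (S (F - u) ≡ S F)

-- A set of Boolean intervals of P(E) is represented by its (decidable)
-- membership predicate: B U V ≡ true  means  [U,V] ∈ B.
IntervalSet : ℕ → Set
IntervalSet n = Subset n → Subset n → Bool

_∈[_,_] : ∀ {n} → Subset n → Subset n → Subset n → Set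
I ∈[ U , V ] = (U ⊆ I) × (I ⊆ V)

record IsBooleanIntervalPartition {n} (P : IntervalSet n) : Set where
  field
    blocks-intervals : ∀ U V → P U V ≡ true → U ⊆ V
    disjoint : ∀ U V U′ V′ → P U V ≡ true → P U′ V′ ≡ true →
               ∀ I → I ∈[ U , V ] → I ∈[ U′ , V′ ] → (U ≡ U′) × (V ≡ V′)
    cover : ∀ I → ∃[ U ] ∃[ V ] ((P U V ≡ true) × I ∈[ U , V ])

shadeToPartition : ∀ {n} → (Subset n → Subset n) → IntervalSet n
shadeToPartition {n} S U V =
  any (λ F → (U =S (F ∩ S F)) ∧ (V =S (F ∪ ∁ (S F)))) (allSubsets n)

-- the blocks [α,τ] of P containing F (a singleton list when P is a partition)
blocksContaining : ∀ {n} → IntervalSet n → Subset n → List (Subset n × Subset n)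
blocksContaining {n} P F =
  filter (λ { (U , V) → T? (P U V ∧ (U ⊆B F) ∧ (F ⊆B V)) })
    (concatMap (λ U → map (λ V → (U , V)) (allSubsets n)) (allSubsets n))

-- The inverse map: P ↦ (F ↦ E ∖ (τ(F) ∖ α(F))), where [α(F),τ(F)] is the
-- unique block of P containing F.  (The fallback value for an empty list is
-- irrelevant when P is a partition.)
partitionToShade : ∀ {n} → IntervalSet n → Subset n → Subset n
partitionToShade P F with blocksContaining P F
... | [] = ⊥
... | (α , τ) ∷ _ = ∁ (τ ─ α)

{-# OPTIONS --safe #-}
-- A set I lies in [F ∩ X , F ∪ ∁ X] exactly when I agrees with F on X.  For a
-- shade map S, walking from F to such an I one coordinate at a time only flips
-- coordinates outside S F, which by the shade property leaves S unchanged; so S is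
-- constant on the block [F ∩ S F , F ∪ ∁ (S F)], any two blocks sharing a set
-- coincide, and the blocks cover P(E).  Conversely, F ↦ ∁ (τ ─ α) read off a
-- partition is constant on each block, and flipping a coordinate of τ ─ α keeps F
-- inside [α , τ].  The round trips are the Boolean identities
-- ∁ ((F ∪ ∁ X) ─ (F ∩ X)) = X and, for α ⊆ F ⊆ τ, F ∩ ∁ (τ ─ α) = α and
-- F ∪ (τ ─ α) = τ.
module Submission where

open import Defs
open import Data.Nat using (ℕ)
open import Data.Fin.Subset using (Subset)
open import Data.Product using (_×_)
open import Relation.Binary.PropositionalEquality using (_≡_)

open import Data.Bool using (Bool; true; false; T)
open import Data.Bool.Properties using (T-≡; T-∧) renaming (_≟_ to _≟B_)
open import Data.Fin using (Fin; zero; suc; _≟_)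
open import Data.Fin.Subset using (_∈_; _∉_; _⊆_; _∩_; _∪_; ∁; _─_; ⁅_⁆; _-_; inside; outside)
open import Data.Fin.Subset.Properties
  using (_∈?_; _⊆?_; ⊆-antisym; ⊆-trans; x∈p∩q⁺; x∈p∩q⁻; x∈p∪q⁻; p⊆p∪q; q⊆p∪q; p∩q⊆p;
         x∈∁p⇒x∉p; x∉∁p⇒x∈p; x∈p⇒x∉∁p; x∉p⇒x∈∁p; x∈p∧x∉q⇒x∈p─q; p─q⊆p; p─⊥≡p;
         x∈⁅y⁆⇒x≡y; x∈p∧x≢y⇒x∈p-y; ∪-identityʳ)
open import Data.Vec using ([]; _∷_; here; there; lookup; _[_]≔_)
open import Data.Vec.Properties
  using (≡-dec; []=⇒lookup; lookup⇒[]=; lookup∘update; lookup∘update′; []≔-lookup)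
open import Data.Vec.Relation.Binary.Pointwise.Extensional using (ext; Pointwise-≡⇒≡)
open import Data.List using (List; []; _∷_; allFin; concatMap; map)
open import Data.List.Relation.Unary.Any using (here; there; satisfied)
open import Data.List.Relation.Unary.Any.Properties using (any⁺; any⁻; ¬Any[])
open import Data.List.Membership.Propositional using (lose) renaming (_∈_ to _∈ₗ_)
open import Data.List.Membership.Propositional.Properties
  using (∈-map⁺; ∈-++⁺ˡ; ∈-++⁺ʳ; ∈-concatMap⁺; ∈-filter⁺; ∈-filter⁻; ∈-allFin)
open import Data.Product using (_,_; proj₁; proj₂; ∃-syntax)
open import Data.Sum using ([_,_]; inj₁; inj₂)
open import Function using (_∘_; id)
open import Function.Bundles using (Equivalence)
open import Relation.Nullary using (Dec; does; yes; no; contradiction)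
open import Relation.Nullary.Decidable using (decidable-stable; dec-true)
open import Relation.Binary.PropositionalEquality using (refl; sym; trans; cong; subst; _≢_)

private
  variable
    n : ℕ
    F I U V X : Subset n

x∈p─q⇒x∉q : ∀ {x : Fin n} {p q} → x ∈ p ─ q → x ∉ q
x∈p─q⇒x∉q {p = _ ∷ _} {inside ∷ _} () here
x∈p─q⇒x∉q {p = _ ∷ _} {_ ∷ _} (there x∈) (there x∈q) = x∈p─q⇒x∉q x∈ x∈q

p[x]≔inside≡p∪⁅x⁆ : ∀ (p : Subset n) x → p [ x ]≔ inside ≡ p ∪ ⁅ x ⁆
p[x]≔inside≡p∪⁅x⁆ (inside  ∷ p) zero    = cong (inside ∷_) (sym (∪-identityʳ p))
p[x]≔inside≡p∪⁅x⁆ (outside ∷ p) zero    = cong (inside ∷_) (sym (∪-identityʳ p))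
p[x]≔inside≡p∪⁅x⁆ (inside  ∷ p) (suc x) = cong (inside ∷_) (p[x]≔inside≡p∪⁅x⁆ p x)
p[x]≔inside≡p∪⁅x⁆ (outside ∷ p) (suc x) = cong (outside ∷_) (p[x]≔inside≡p∪⁅x⁆ p x)

p[x]≔outside≡p-x : ∀ (p : Subset n) x → p [ x ]≔ outside ≡ p - x
p[x]≔outside≡p-x (s ∷ p) zero    = cong (outside ∷_) (sym (p─⊥≡p p))
p[x]≔outside≡p-x (s ∷ p) (suc x) = cong (s ∷_) (p[x]≔outside≡p-x p x)

∁[[p∪∁q]─[p∩q]]≡q : ∀ (p q : Subset n) → ∁ ((p ∪ ∁ q) ─ (p ∩ q)) ≡ q
∁[[p∪∁q]─[p∩q]]≡q []            []            = refl
∁[[p∪∁q]─[p∩q]]≡q (inside  ∷ p) (inside  ∷ q) = cong (inside ∷_) (∁[[p∪∁q]─[p∩q]]≡q p q)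
∁[[p∪∁q]─[p∩q]]≡q (inside  ∷ p) (outside ∷ q) = cong (outside ∷_) (∁[[p∪∁q]─[p∩q]]≡q p q)
∁[[p∪∁q]─[p∩q]]≡q (outside ∷ p) (inside  ∷ q) = cong (inside ∷_) (∁[[p∪∁q]─[p∩q]]≡q p q)
∁[[p∪∁q]─[p∩q]]≡q (outside ∷ p) (outside ∷ q) = cong (outside ∷_) (∁[[p∪∁q]─[p∩q]]≡q p q)

p⊆q⊆r⇒q∩∁[r─p]≡p : ∀ {p q r : Subset n} → p ⊆ q → q ⊆ r → q ∩ ∁ (r ─ p) ≡ p
p⊆q⊆r⇒q∩∁[r─p]≡p {p = p} {q} {r} p⊆q q⊆r = ⊆-antisym ⊆p p⊆
  where
  ⊆p : q ∩ ∁ (r ─ p) ⊆ p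
  ⊆p {x} x∈ = decidable-stable (x ∈? p) λ x∉p →
    x∈∁p⇒x∉p (proj₂ (x∈p∩q⁻ q _ x∈)) (x∈p∧x∉q⇒x∈p─q (q⊆r (proj₁ (x∈p∩q⁻ q _ x∈))) x∉p)
  p⊆ : p ⊆ q ∩ ∁ (r ─ p)
  p⊆ x∈p = x∈p∩q⁺ (p⊆q x∈p , x∉p⇒x∈∁p (λ x∈r─p → x∈p─q⇒x∉q x∈r─p x∈p))

p⊆q⊆r⇒q∪∁∁[r─p]≡r : ∀ {p q r : Subset n} → p ⊆ q → q ⊆ r → q ∪ ∁ (∁ (r ─ p)) ≡ r
p⊆q⊆r⇒q∪∁∁[r─p]≡r {p = p} {q} {r} p⊆q q⊆r = ⊆-antisym ⊆r r⊆
  where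
  ⊆r : q ∪ ∁ (∁ (r ─ p)) ⊆ r
  ⊆r x∈ = [ q⊆r , (λ x∈∁∁ → p─q⊆p r p (x∉∁p⇒x∈p (x∈∁p⇒x∉p x∈∁∁))) ] (x∈p∪q⁻ q _ x∈)
  r⊆ : r ⊆ q ∪ ∁ (∁ (r ─ p))
  r⊆ {x} x∈r with x ∈? p
  ... | yes x∈p = p⊆p∪q _ (p⊆q x∈p)
  ... | no x∉p  = q⊆p∪q q _ (x∉p⇒x∈∁p (x∈p⇒x∉∁p (x∈p∧x∉q⇒x∈p─q x∈r x∉p)))

∈[∩,∪∁]-refl : ∀ (F X : Subset n) → F ∈[ F ∩ X , F ∪ ∁ X ]
∈[∩,∪∁]-refl F X = p∩q⊆p F X , p⊆p∪q (∁ X)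

∈[∩,∪∁]⇒same-endpoints : I ∈[ F ∩ X , F ∪ ∁ X ] → (I ∩ X ≡ F ∩ X) × (I ∪ ∁ X ≡ F ∪ ∁ X)
∈[∩,∪∁]⇒same-endpoints {I = I} {F = F} {X = X} (lo , hi) =
  ⊆-antisym I∩X⊆ (λ x∈ → x∈p∩q⁺ (lo x∈ , proj₂ (x∈p∩q⁻ F X x∈))) ,
  ⊆-antisym (λ x∈ → [ hi , q⊆p∪q F _ ] (x∈p∪q⁻ I _ x∈)) ⊆I∪∁X
  where
  I∩X⊆ : I ∩ X ⊆ F ∩ X
  I∩X⊆ x∈ with x∈p∩q⁻ I X x∈
  ... | x∈I , x∈X = [ (λ x∈F → x∈p∩q⁺ (x∈F , x∈X)) , (λ x∈∁X → contradiction x∈X (x∈∁p⇒x∉p x∈∁X)) ]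
                      (x∈p∪q⁻ F _ (hi x∈I))
  ⊆I∪∁X : F ∪ ∁ X ⊆ I ∪ ∁ X
  ⊆I∪∁X {x} x∈ with x∈p∪q⁻ F _ x∈ | x ∈? X
  ... | _            | no x∉X = q⊆p∪q I _ (x∉p⇒x∈∁p x∉X)
  ... | inj₁ x∈F     | yes x∈X = p⊆p∪q _ (lo (x∈p∩q⁺ (x∈F , x∈X)))
  ... | inj₂ x∈∁X    | yes x∈X = contradiction x∈X (x∈∁p⇒x∉p x∈∁X)

lookup≡outside⇒∉ : ∀ {p : Subset n} {i} → lookup p i ≡ outside → i ∉ p
lookup≡outside⇒∉ p[i]≡outside i∈p with trans (sym ([]=⇒lookup i∈p)) p[i]≡outside
... | ()

AgreeOn : Subset n → Subset n → Subset n → Set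
AgreeOn X F I = ∀ {i} → i ∈ X → lookup F i ≡ lookup I i

∈[∩,∪∁]⇒AgreeOn : I ∈[ F ∩ X , F ∪ ∁ X ] → AgreeOn X F I
∈[∩,∪∁]⇒AgreeOn {I = I} {F = F} {X = X} (lo , hi) {i} i∈X with lookup F i in eF | lookup I i in eI
... | inside  | inside  = refl
... | outside | outside = refl
... | inside  | outside = contradiction (lo (x∈p∩q⁺ (lookup⇒[]= i F eF , i∈X))) (lookup≡outside⇒∉ eI)
... | outside | inside  = contradiction (x∈p∪q⁻ F _ (hi (lookup⇒[]= i I eI)))
                            [ lookup≡outside⇒∉ eF , (λ i∈∁X → x∈∁p⇒x∉p i∈∁X i∈X) ]

insert-∈[,] : ∀ {x : Fin n} → x ∈ V ─ U → F ∈[ U , V ] → (F ∪ ⁅ x ⁆) ∈[ U , V ]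
insert-∈[,] {V = V} {U} {F} x∈V─U (U⊆F , F⊆V) = p⊆p∪q _ ∘ U⊆F , λ y∈ →
  [ F⊆V , (λ y∈⁅x⁆ → subst (_∈ V) (sym (x∈⁅y⁆⇒x≡y _ y∈⁅x⁆)) (p─q⊆p V U x∈V─U)) ] (x∈p∪q⁻ F _ y∈)

remove-∈[,] : ∀ {x : Fin n} → x ∈ V ─ U → F ∈[ U , V ] → (F - x) ∈[ U , V ]
remove-∈[,] {V = V} {U} {F} x∈V─U (U⊆F , F⊆V) =
  (λ y∈U → x∈p∧x≢y⇒x∈p-y (U⊆F y∈U) λ { refl → x∈p─q⇒x∉q x∈V─U y∈U }) ,
  F⊆V ∘ p─q⊆p F _

T-does⁺ : ∀ {A : Set} (a? : Dec A) → A → T (does a?)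
T-does⁺ a? a = Equivalence.from T-≡ (dec-true a? a)

T-does⁻ : ∀ {A : Set} (a? : Dec A) → T (does a?) → A
T-does⁻ (yes a) _ = a

true⇔true⇒≡ : ∀ {a b : Bool} → (a ≡ true → b ≡ true) → (b ≡ true → a ≡ true) → a ≡ b
true⇔true⇒≡ {true}  a⇒b _   = sym (a⇒b refl)
true⇔true⇒≡ {false} {true}  _ b⇒a = b⇒a refl
true⇔true⇒≡ {false} {false} _ _   = refl

∈-allSubsets : ∀ (F : Subset n) → F ∈ₗ allSubsets n
∈-allSubsets []            = here refl
∈-allSubsets (inside  ∷ F) = ∈-++⁺ˡ (∈-map⁺ (inside ∷_) (∈-allSubsets F))
∈-allSubsets (outside ∷ F) = ∈-++⁺ʳ _ (∈-map⁺ (outside ∷_) (∈-allSubsets F))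

shadeToPartition⁺ : ∀ (S : Subset n → Subset n) F → U ≡ F ∩ S F → V ≡ F ∪ ∁ (S F) →
                    shadeToPartition S U V ≡ true
shadeToPartition⁺ S F U≡ V≡ =
  Equivalence.to T-≡ (any⁺ {xs = allSubsets _} _ (lose (∈-allSubsets F) F-witness))
  where
  F-witness = Equivalence.from T-∧ (T-does⁺ (≡-dec _≟B_ _ _) U≡ , T-does⁺ (≡-dec _≟B_ _ _) V≡)

shadeToPartition⁻ : ∀ (S : Subset n → Subset n) U V → shadeToPartition S U V ≡ true →
                    ∃[ F ] (U ≡ F ∩ S F) × (V ≡ F ∪ ∁ (S F))
shadeToPartition⁻ S U V e with satisfied (any⁻ _ (allSubsets _) (Equivalence.from T-≡ e))
... | F , t with Equivalence.to T-∧ t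
... | U≡ , V≡ = F , T-does⁻ (≡-dec _≟B_ _ _) U≡ , T-does⁻ (≡-dec _≟B_ _ _) V≡

module _ (P : IntervalSet n) where

  -- the list that blocksContaining filters, spelled out since ∈-filter⁺/⁻ cannot infer it
  private
    candidates : List (Subset n × Subset n)
    candidates = concatMap (λ U → map (λ V → (U , V)) (allSubsets n)) (allSubsets n)

  ∈-blocksContaining⁺ : P U V ≡ true → F ∈[ U , V ] → (U , V) ∈ₗ blocksContaining P F
  ∈-blocksContaining⁺ {U = U} {V} {F} PUV (U⊆F , F⊆V) =
    ∈-filter⁺ _ {xs = candidates} (∈-concatMap⁺ _ (lose (∈-allSubsets U) (∈-map⁺ _ (∈-allSubsets V))))
      (Equivalence.from T-∧ (Equivalence.from T-≡ PUV , Equivalence.from T-∧ (U⊆F-holds , F⊆V-holds)))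
    where
    U⊆F-holds = T-does⁺ (U ⊆? F) U⊆F
    F⊆V-holds = T-does⁺ (F ⊆? V) F⊆V

  ∈-blocksContaining⁻ : (U , V) ∈ₗ blocksContaining P F → (P U V ≡ true) × F ∈[ U , V ]
  ∈-blocksContaining⁻ {U = U} {V} {F} m
    with Equivalence.to T-∧ (proj₂ (∈-filter⁻ _ {xs = candidates} m))
  ... | PUV , t with Equivalence.to T-∧ t
  ... | U⊆F , F⊆V = Equivalence.to T-≡ PUV , T-does⁻ (U ⊆? F) U⊆F , T-does⁻ (F ⊆? V) F⊆V

module _ (P : IntervalSet n) (isPartition : IsBooleanIntervalPartition P) where
  open IsBooleanIntervalPartition isPartition

  blocksContaining-unique : P U V ≡ true → F ∈[ U , V ] →
                           ∀ {b} → b ∈ₗ blocksContaining P F → b ≡ (U , V)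
  blocksContaining-unique PUV F∈ {α , τ} b∈ with ∈-blocksContaining⁻ P b∈
  ... | Pατ , F∈′ with disjoint α τ _ _ Pατ PUV _ F∈′ F∈
  ... | refl , refl = refl

  partitionToShade-block : P U V ≡ true → F ∈[ U , V ] → partitionToShade P F ≡ ∁ (V ─ U)
  partitionToShade-block {F = F} PUV F∈
    with blocksContaining P F | ∈-blocksContaining⁺ P PUV F∈ | blocksContaining-unique PUV F∈
  ... | _ ∷ _ | _ | unique with unique (here refl)
  ... | refl = refl

  partitionToShade-isShadeMap : IsShadeMap (partitionToShade P)
  partitionToShade-isShadeMap F u u∉ with cover F
  ... | U , V , PUV , F∈ = shade-of (insert-∈[,] u∈V─U F∈) , shade-of (remove-∈[,] u∈V─U F∈)
    where
    u∈V─U : u ∈ V ─ U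
    u∈V─U = x∉∁p⇒x∈p (subst (u ∉_) (partitionToShade-block PUV F∈) u∉)
    shade-of : ∀ {G} → G ∈[ U , V ] → partitionToShade P G ≡ partitionToShade P F
    shade-of G∈ = trans (partitionToShade-block PUV G∈) (sym (partitionToShade-block PUV F∈))

  shadeToPartition∘partitionToShade⇒ : shadeToPartition (partitionToShade P) U V ≡ true → P U V ≡ true
  shadeToPartition∘partitionToShade⇒ {U = U} {V} e with shadeToPartition⁻ (partitionToShade P) U V e
  ... | F , refl , refl with cover F
  ... | α , τ , Pατ , α⊆F , F⊆τ
    rewrite partitionToShade-block Pατ (α⊆F , F⊆τ)
          | p⊆q⊆r⇒q∩∁[r─p]≡p α⊆F F⊆τ | p⊆q⊆r⇒q∪∁∁[r─p]≡r α⊆F F⊆τ = Pατ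

  shadeToPartition∘partitionToShade⇐ : P U V ≡ true → shadeToPartition (partitionToShade P) U V ≡ true
  shadeToPartition∘partitionToShade⇐ {U = U} {V} PUV = shadeToPartition⁺ (partitionToShade P) U
    (sym (trans (cong (U ∩_) shade-U) (p⊆q⊆r⇒q∩∁[r─p]≡p id U⊆V)))
    (sym (trans (cong (λ X → U ∪ ∁ X) shade-U) (p⊆q⊆r⇒q∪∁∁[r─p]≡r id U⊆V)))
    where
    U⊆V = blocks-intervals U V PUV
    shade-U = partitionToShade-block PUV (id , U⊆V)

  shadeToPartition∘partitionToShade : ∀ U V → shadeToPartition (partitionToShade P) U V ≡ P U V
  shadeToPartition∘partitionToShade U V =
    true⇔true⇒≡ shadeToPartition∘partitionToShade⇒ shadeToPartition∘partitionToShade⇐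

module _ (S : Subset n → Subset n) (isShade : IsShadeMap S) where

  shade-update : ∀ F {u} b → u ∉ S F → S (F [ u ]≔ b) ≡ S F
  shade-update F {u} inside  u∉ = trans (cong S (p[x]≔inside≡p∪⁅x⁆ F u)) (proj₁ (isShade F u u∉))
  shade-update F {u} outside u∉ = trans (cong S (p[x]≔outside≡p-x F u)) (proj₂ (isShade F u u∉))

  shade-copy : ∀ F I d → AgreeOn (S F) F I → S (F [ d ]≔ lookup I d) ≡ S F
  shade-copy F I d agree with d ∈? S F
  ... | yes d∈ = cong S (trans (cong (F [ d ]≔_) (sym (agree d∈))) ([]≔-lookup F d))
  ... | no d∉  = shade-update F (lookup I d) d∉

  shade-walk : ∀ (ds : List (Fin n)) F I → (∀ i → lookup F i ≢ lookup I i → i ∈ₗ ds) →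
               AgreeOn (S F) F I → S I ≡ S F
  shade-walk [] F I differ _ = cong S (sym (Pointwise-≡⇒≡ (ext F≗I)))
    where
    F≗I : ∀ i → lookup F i ≡ lookup I i
    F≗I i = decidable-stable (lookup F i ≟B lookup I i) (¬Any[] ∘ differ i)
  shade-walk (d ∷ ds) F I differ agree = trans (shade-walk ds F′ I differ′ agree′) SF′≡SF
    where
    F′ = F [ d ]≔ lookup I d
    SF′≡SF : S F′ ≡ S F
    SF′≡SF = shade-copy F I d agree
    differ′ : ∀ i → lookup F′ i ≢ lookup I i → i ∈ₗ ds
    differ′ i F′i≢Ii with i ≟ d
    ... | yes refl = contradiction (lookup∘update d F (lookup I d)) F′i≢Ii
    ... | no i≢d with differ i (λ Fi≡Ii → F′i≢Ii (trans (lookup∘update′ i≢d F (lookup I d)) Fi≡Ii))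
    ...   | here refl  = contradiction refl i≢d
    ...   | there i∈ds = i∈ds
    agree′ : AgreeOn (S F′) F′ I
    agree′ {i} i∈ with i ≟ d
    ... | yes refl = lookup∘update d F (lookup I d)
    ... | no i≢d   = trans (lookup∘update′ i≢d F (lookup I d)) (agree (subst (i ∈_) SF′≡SF i∈))

  shade-constant-on-block : I ∈[ F ∩ S F , F ∪ ∁ (S F) ] → S I ≡ S F
  shade-constant-on-block {I = I} {F = F} I∈ =
    shade-walk (allFin n) F I (λ i _ → ∈-allFin i) (∈[∩,∪∁]⇒AgreeOn I∈)

  block-canonical : I ∈[ F ∩ S F , F ∪ ∁ (S F) ] →
                    (I ∩ S I ≡ F ∩ S F) × (I ∪ ∁ (S I) ≡ F ∪ ∁ (S F))
  block-canonical I∈ rewrite shade-constant-on-block I∈ = ∈[∩,∪∁]⇒same-endpoints I∈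

  shadeToPartition-isPartition : IsBooleanIntervalPartition (shadeToPartition S)
  shadeToPartition-isPartition = record
    { blocks-intervals = intervals
    ; disjoint         = disjoint
    ; cover            = λ I → _ , _ , shadeToPartition⁺ S I refl refl , ∈[∩,∪∁]-refl I (S I)
    }
    where
    intervals : ∀ U V → shadeToPartition S U V ≡ true → U ⊆ V
    intervals U V e with shadeToPartition⁻ S U V e
    ... | F , refl , refl = ⊆-trans (proj₁ (∈[∩,∪∁]-refl F (S F))) (proj₂ (∈[∩,∪∁]-refl F (S F)))
    disjoint : ∀ U V U′ V′ → shadeToPartition S U V ≡ true → shadeToPartition S U′ V′ ≡ true →
               ∀ I → I ∈[ U , V ] → I ∈[ U′ , V′ ] → (U ≡ U′) × (V ≡ V′)
    disjoint U V U′ V′ e e′ I I∈ I∈′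
      with shadeToPartition⁻ S U V e | shadeToPartition⁻ S U′ V′ e′
    ... | F , refl , refl | F′ , refl , refl =
      trans (sym (proj₁ (block-canonical I∈))) (proj₁ (block-canonical I∈′)) ,
      trans (sym (proj₂ (block-canonical I∈))) (proj₂ (block-canonical I∈′))

  partitionToShade∘shadeToPartition : ∀ F → partitionToShade (shadeToPartition S) F ≡ S F
  partitionToShade∘shadeToPartition F =
    trans (partitionToShade-block (shadeToPartition S) shadeToPartition-isPartition
             (shadeToPartition⁺ S F refl refl) (∈[∩,∪∁]-refl F (S F)))
          (∁[[p∪∁q]─[p∩q]]≡q F (S F))

theorem4p33 : (n : ℕ) →
  -- the forward map lands in Boolean interval partitions
  (∀ (S : Subset n → Subset n) → IsShadeMap S →
     IsBooleanIntervalPartition (shadeToPartition S))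
  -- the inverse map lands in shade maps
  × (∀ (P : IntervalSet n) → IsBooleanIntervalPartition P →
     IsShadeMap (partitionToShade P))
  -- inverse ∘ forward = id on shade maps
  × (∀ (S : Subset n → Subset n) → IsShadeMap S →
     ∀ F → partitionToShade (shadeToPartition S) F ≡ S F)
  -- forward ∘ inverse = id on Boolean interval partitions
  × (∀ (P : IntervalSet n) → IsBooleanIntervalPartition P →
     ∀ U V → shadeToPartition (partitionToShade P) U V ≡ P U V)
theorem4p33 n =
  shadeToPartition-isPartition ,
  partitionToShade-isShadeMap ,
  partitionToShade∘shadeToPartition ,
  shadeToPartition∘partitionToShade
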